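{- Let $\mathcal{M}$ be a regular matroid. Then there is an isomorphism of abelian groups $\mathrm{Jac}(\mathcal{M})\cong_{\mathbb{Z}}\mathrm{Jac}_{\mathbb{Z}}(\mathcal{M})\oplus\mathrm{Jac}_{\mathbb{Z}}(\mathcal{M})$.
   Context: A regular matroid $\mathcal{M}$ (on an $n$-element ground set) is one represented over $\mathbb{R}$ by a totally unimodular integer matrix $M$ (every square subdeterminant in $\{0,\pm1\}$). Its Jacobian group is $\mathrm{Jac}_{\mathbb{Z}}(\mathcal{M})=\mathbb{Z}^n/(\Lambda_{\mathbb{Z}}(M)\oplus\Lambda^*_{\mathbb{Z}}(M))$ with $\Lambda_{\mathbb{Z}}(M)=\ker_{\mathbb{R}}(M)\cap\mathbb{Z}^n$ (kernel of $v\mapsto vM^{T}$ on row vectors) and $\Lambda^*_{\mathbb{Z}}(M)=\mathrm{row}_{\mathbb{R}}(M)\cap\mathbb{Z}^n$; this is independent of the choice of totally unimodular $M$ up to isomorphism. Let $\omega=e^{2\pi i/6}$, $\mathcal{E}=\mathbb{Z}[\omega]$, $\mathbb{H}=\{z\in\mathbb{C}:z^6=1\}\cup\{0\}$. An $\mathbb{H}$-matrix is a complex matrix all of whose square subdeterminants lie in $\mathbb{H}$; an $\mathbb{H}$-representation of $\mathcal{M}$ is an $\mathbb{H}$-matrix representing $\mathcal{M}$ over $\mathbb{C}$. For such $M'$, $\mathrm{Jac}(M')=\mathcal{E}^n/(\Lambda_{\mathcal{E}}(M')\oplus\Lambda^*_{\mathcal{E}}(M'))$ with $\Lambda^*_{\mathcal{E}}(M')=\mathrm{row}_{\mathbb{C}}(M')\cap\mathcal{E}^n$,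 $\Lambda_{\mathcal{E}}(M')=\{v\in\mathbb{C}^n: vM'^{\mathrm H}=0\}\cap\mathcal{E}^n$ ($\mathrm H$ = conjugate transpose). For regular $\mathcal{M}$, $\mathrm{Jac}(M')$ is independent of the $\mathbb{H}$-representation $M'$ up to $\mathcal{E}$-module isomorphism and is denoted $\mathrm{Jac}(\mathcal{M})$, regarded here as an abelian group. -}

module Defs where

open import Data.Nat using (ℕ; zero; suc)
open import Data.Fin using (Fin; zero; suc; punchIn)
open import Data.Integer as ℤ using (ℤ; +_)
open import Data.Rational as ℚ using (ℚ)
open import Data.Product using (_×_; _,_; proj₁; proj₂; Σ; ∃; ∃-syntax)
open import Data.Sum using (_⊎_)
open import Relation.Binary.PropositionalEquality using (_≡_)

∑ : {A : Set} → A → (A → A → A) → {k : ℕ} → (Fin k → A) → A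
∑ z _⊕_ {zero}  f = z
∑ z _⊕_ {suc k} f = f zero ⊕ ∑ z _⊕_ (λ i → f (suc i))

∑ℤ : {k : ℕ} → (Fin k → ℤ) → ℤ
∑ℤ = ∑ (+ 0) ℤ._+_

∑ℚ : {k : ℕ} → (Fin k → ℚ) → ℚ
∑ℚ = ∑ ℚ.0ℚ ℚ._+_

-- Matrices: an m × n matrix has rows indexed by Fin m and columns
-- (= ground set elements of the matroid) indexed by Fin n.

Mat : Set → ℕ → ℕ → Set
Mat A m n = Fin m → Fin n → A

altSign : {k : ℕ} → Fin k → ℤ
altSign zero    = + 1
altSign (suc j) = ℤ.- altSign j

det : (k : ℕ) → Mat ℤ k k → ℤ
det zero    A = + 1
det (suc k) A =
  ∑ℤ (λ j → altSign j ℤ.* (A zero j ℤ.* det k (λ i l → A (suc i) (punchIn j l))))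

-- A k × k submatrix is given by row/column selections r, c; non-injective
-- selections give determinant 0, so quantifying over all maps is harmless.
TotallyUnimodular : {m n : ℕ} → Mat ℤ m n → Set
TotallyUnimodular {m} {n} M =
  (k : ℕ) (r : Fin k → Fin m) (c : Fin k → Fin n) →
  let d = det k (λ i j → M (r i) (c j)) in
  (d ≡ + 0) ⊎ ((d ≡ + 1) ⊎ (d ≡ ℤ.- (+ 1)))

-- Integral Jacobian  Jac_ℤ(M) = ℤ^n / (Λ_ℤ(M) ⊕ Λ*_ℤ(M))

Vecℤ : ℕ → Set
Vecℤ n = Fin n → ℤ

Λℤ : {m n : ℕ} → Mat ℤ m n → Vecℤ n → Set
Λℤ M v = ∀ i → ∑ℤ (λ j → v j ℤ.* M i j) ≡ + 0

-- Λ*_ℤ(M) : integer vectors in the real row space of M.  Since M is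
-- rational, row_ℝ(M) ∩ ℚ^n = row_ℚ(M), so rational coefficients suffice.
Λ*ℤ : {m n : ℕ} → Mat ℤ m n → Vecℤ n → Set
Λ*ℤ {m} M v = Σ (Fin m → ℚ) λ c → ∀ j → ∑ℚ (λ i → c i ℚ.* (M i j ℚ./ 1)) ≡ (v j ℚ./ 1)

_≈ℤ[_]_ : {m n : ℕ} → Vecℤ n → Mat ℤ m n → Vecℤ n → Set
x ≈ℤ[ M ] y = ∃[ a ] ∃[ b ] (Λℤ M a × Λ*ℤ M b × (∀ j → x j ℤ.- y j ≡ a j ℤ.+ b j))

-- Eisenstein integers  ℰ = ℤ[ω], ω = e^{2πi/6}, ω² = ω - 1.
-- (a , b) represents a + bω.

ℰ : Set
ℰ = ℤ × ℤ

0ℰ : ℰ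
0ℰ = (+ 0 , + 0)

_+ℰ_ : ℰ → ℰ → ℰ
(a , b) +ℰ (c , d) = (a ℤ.+ c , b ℤ.+ d)

-ℰ_ : ℰ → ℰ
-ℰ (a , b) = (ℤ.- a , ℤ.- b)

_-ℰ_ : ℰ → ℰ → ℰ
x -ℰ y = x +ℰ (-ℰ y)

-- (a + bω)(c + dω) = (ac - bd) + (ad + bc + bd)ω
_*ℰ_ : ℰ → ℰ → ℰ
(a , b) *ℰ (c , d) = (a ℤ.* c ℤ.- b ℤ.* d , a ℤ.* d ℤ.+ b ℤ.* c ℤ.+ b ℤ.* d)

-- complex conjugation: ω̄ = 1 - ω
conjℰ : ℰ → ℰ
conjℰ (a , b) = (a ℤ.+ b , ℤ.- b)

ιℰ : ℤ → ℰ
ιℰ a = (a , + 0)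

∑ℰ : {k : ℕ} → (Fin k → ℰ) → ℰ
∑ℰ = ∑ 0ℰ _+ℰ_

-- ℚ(ω) (the subfield of ℂ generated by ℰ), same representation
ℚω : Set
ℚω = ℚ × ℚ

_*ℚω_ : ℚω → ℚω → ℚω
(a , b) *ℚω (c , d) = (a ℚ.* c ℚ.- b ℚ.* d , a ℚ.* d ℚ.+ b ℚ.* c ℚ.+ b ℚ.* d)

_+ℚω_ : ℚω → ℚω → ℚω
(a , b) +ℚω (c , d) = (a ℚ.+ c , b ℚ.+ d)

∑ℚω : {k : ℕ} → (Fin k → ℚω) → ℚω
∑ℚω = ∑ (ℚ.0ℚ , ℚ.0ℚ) _+ℚω_

ℰ→ℚω : ℰ → ℚω
ℰ→ℚω (a , b) = (a ℚ./ 1 , b ℚ./ 1)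

-- Jacobian of an ℰ-matrix M'  Jac(M') = ℰ^n / (Λ_ℰ(M') ⊕ Λ*_ℰ(M'))

Vecℰ : ℕ → Set
Vecℰ n = Fin n → ℰ

Λℰ : {m n : ℕ} → Mat ℰ m n → Vecℰ n → Set
Λℰ M v = ∀ i → ∑ℰ (λ j → v j *ℰ conjℰ (M i j)) ≡ 0ℰ

-- Λ*_ℰ(M') : v ∈ ℰ^n in the complex row space of M'.  Since M' has
-- entries in ℚ(ω), row_ℂ(M') ∩ ℚ(ω)^n = row_ℚ(ω)(M').
Λ*ℰ : {m n : ℕ} → Mat ℰ m n → Vecℰ n → Set
Λ*ℰ {m} M v =
  Σ (Fin m → ℚω) λ c → ∀ j → ∑ℚω (λ i → c i *ℚω ℰ→ℚω (M i j)) ≡ ℰ→ℚω (v j)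

_≈ℰ[_]_ : {m n : ℕ} → Vecℰ n → Mat ℰ m n → Vecℰ n → Set
x ≈ℰ[ M ] y = ∃[ a ] ∃[ b ] (Λℰ M a × Λ*ℰ M b × (∀ j → x j -ℰ y j ≡ a j +ℰ b j))

-- A totally unimodular matrix, viewed as a complex matrix, is an
-- ℍ-representation of the same matroid; Jac(ℳ) is computed from it.
toℰ : {m n : ℕ} → Mat ℤ m n → Mat ℰ m n
toℰ M i j = ιℰ (M i j)

-- Isomorphism of abelian groups between quotient groups A/~ and B/≈,
-- presented on representatives: f induces a well-defined additive map
-- with two-sided inverse induced by g.

record QuotIso (A B : Set)
               (_+A_ : A → A → A) (_~_ : A → A → Set)
               (_+B_ : B → B → B) (_≈_ : B → B → Set) : Set where
  field
    f       : A → B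
    g       : B → A
    f-cong  : ∀ {x y} → x ~ y → f x ≈ f y
    g-cong  : ∀ {x y} → x ≈ y → g x ~ g y
    f-hom   : ∀ x y → f (x +A y) ≈ (f x +B f y)
    f∘g     : ∀ y → f (g y) ≈ y
    g∘f     : ∀ x → g (f x) ~ x

JacIso : {m n : ℕ} → Mat ℤ m n → Set
JacIso {m} {n} M =
  QuotIso (Vecℰ n) (Vecℤ n × Vecℤ n)
    (λ x y j → x j +ℰ y j) (λ x y → x ≈ℰ[ toℰ M ] y)
    (λ x y → (λ j → proj₁ x j ℤ.+ proj₁ y j) , (λ j → proj₂ x j ℤ.+ proj₂ y j))
    (λ x y → (proj₁ x ≈ℤ[ M ] proj₁ y) × (proj₂ x ≈ℤ[ M ] proj₂ y))

{-# OPTIONS --safe #-}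
module Submission where

open import Defs
open import Data.Nat using (ℕ; zero; suc)
open import Data.Fin using (Fin; zero; suc)
open import Data.Integer as ℤ using (ℤ; +_)
import Data.Integer.Properties as ℤ
open import Data.Rational as ℚ using (ℚ)
import Data.Rational.Properties as ℚ
open import Data.Product using (_×_; _,_; proj₁; proj₂; uncurry)
open import Data.Product.Properties using (,-injective)
open import Data.Vec.Functional using (map; zip; unzip)
open import Function.Bundles using (_⇔_; mk⇔; module Equivalence)
open import Relation.Binary.PropositionalEquality

-- An integer matrix M equals its own conjugate, so v ↦ v Mᴴ acts separately on
-- the 1- and ω-coordinates of ℰⁿ = ℤⁿ ⊕ ℤⁿω, and likewise ℚ(ω)-combinations
-- of its rows split as ℚ-combinations on ℚ(ω) = ℚ ⊕ ℚω.  Hence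
-- Λ_ℰ(M) = Λ_ℤ(M) ⊕ Λ_ℤ(M) ω and Λ*_ℰ(M) = Λ*_ℤ(M) ⊕ Λ*_ℤ(M) ω, and splitting
-- coordinates induces Jac(ℳ) ≅ Jac_ℤ(ℳ) ⊕ Jac_ℤ(ℳ).

∑-cong : {A : Set} (z : A) (_⊕_ : A → A → A) {k : ℕ} {f g : Fin k → A} →
         (∀ i → f i ≡ g i) → ∑ z _⊕_ f ≡ ∑ z _⊕_ g
∑-cong z _⊕_ {zero}  f≡g = refl
∑-cong z _⊕_ {suc k} f≡g = cong₂ _⊕_ (f≡g zero) (∑-cong z _⊕_ (λ i → f≡g (suc i)))

∑-idem : {A : Set} (z : A) (_⊕_ : A → A → A) → z ⊕ z ≡ z →
         {k : ℕ} → ∑ z _⊕_ {k} (λ _ → z) ≡ z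
∑-idem z _⊕_ z⊕z≡z {zero}  = refl
∑-idem z _⊕_ z⊕z≡z {suc k} = trans (cong (z ⊕_) (∑-idem z _⊕_ z⊕z≡z {k})) z⊕z≡z

∑-zip : {A B : Set} (zA : A) (_⊕_ : A → A → A) (zB : B) (_⊗_ : B → B → B)
        {k : ℕ} (f : Fin k → A) (g : Fin k → B) →
        ∑ (zA , zB) (λ x y → (proj₁ x ⊕ proj₁ y , proj₂ x ⊗ proj₂ y)) (zip f g)
          ≡ (∑ zA _⊕_ f , ∑ zB _⊗_ g)
∑-zip zA _⊕_ zB _⊗_ {zero}  f g = refl
∑-zip zA _⊕_ zB _⊗_ {suc k} f g =
  cong (λ s → (f zero ⊕ proj₁ s , g zero ⊗ proj₂ s))
       (∑-zip zA _⊕_ zB _⊗_ (λ i → f (suc i)) (λ i → g (suc i)))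

conjℰ-ιℰ : (a : ℤ) → conjℰ (ιℰ a) ≡ ιℰ a
conjℰ-ιℰ a = cong (_, + 0) (ℤ.+-identityʳ a)

*ℰ-ιℰʳ : (x : ℰ) (a : ℤ) → x *ℰ ιℰ a ≡ (proj₁ x ℤ.* a , proj₂ x ℤ.* a)
*ℰ-ιℰʳ (x , y) a = cong₂ _,_ real omega
  where
  real : x ℤ.* a ℤ.- y ℤ.* + 0 ≡ x ℤ.* a
  real rewrite ℤ.*-zeroʳ y = ℤ.+-identityʳ (x ℤ.* a)
  omega : x ℤ.* + 0 ℤ.+ y ℤ.* a ℤ.+ y ℤ.* + 0 ≡ y ℤ.* a
  omega rewrite ℤ.*-zeroʳ x | ℤ.*-zeroʳ y = trans (ℤ.+-identityʳ _) (ℤ.+-identityˡ _)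

*ℚω-realʳ : (x : ℚω) (q : ℚ) → x *ℚω (q , ℚ.0ℚ) ≡ (proj₁ x ℚ.* q , proj₂ x ℚ.* q)
*ℚω-realʳ (x , y) q = cong₂ _,_ real omega
  where
  real : x ℚ.* q ℚ.- y ℚ.* ℚ.0ℚ ≡ x ℚ.* q
  real rewrite ℚ.*-zeroʳ y = ℚ.+-identityʳ (x ℚ.* q)
  omega : x ℚ.* ℚ.0ℚ ℚ.+ y ℚ.* q ℚ.+ y ℚ.* ℚ.0ℚ ≡ y ℚ.* q
  omega rewrite ℚ.*-zeroʳ x | ℚ.*-zeroʳ y = trans (ℚ.+-identityʳ _) (ℚ.+-identityˡ _)

module _ {m n : ℕ} (M : Mat ℤ m n) where

  _·Mᵀ : Vecℤ n → Fin m → ℤ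
  (u ·Mᵀ) i = ∑ℤ (λ j → u j ℤ.* M i j)

  _·M : (Fin m → ℚ) → Fin n → ℚ
  (c ·M) j = ∑ℚ (λ i → c i ℚ.* (M i j ℚ./ 1))

  ·toℰᴴ-split : (v : Vecℰ n) (i : Fin m) →
                ∑ℰ (λ j → v j *ℰ conjℰ (toℰ M i j))
                  ≡ ((map proj₁ v ·Mᵀ) i , (map proj₂ v ·Mᵀ) i)
  ·toℰᴴ-split v i = begin
    ∑ℰ (λ j → v j *ℰ conjℰ (ιℰ (M i j)))
      ≡⟨ ∑-cong 0ℰ _+ℰ_ (λ j → cong (v j *ℰ_) (conjℰ-ιℰ (M i j))) ⟩
    ∑ℰ (λ j → v j *ℰ ιℰ (M i j))
      ≡⟨ ∑-cong 0ℰ _+ℰ_ (λ j → *ℰ-ιℰʳ (v j) (M i j)) ⟩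
    ∑ℰ (zip (λ j → proj₁ (v j) ℤ.* M i j) (λ j → proj₂ (v j) ℤ.* M i j))
      ≡⟨ ∑-zip (+ 0) ℤ._+_ (+ 0) ℤ._+_ (λ j → proj₁ (v j) ℤ.* M i j)
                                       (λ j → proj₂ (v j) ℤ.* M i j) ⟩
    ((map proj₁ v ·Mᵀ) i , (map proj₂ v ·Mᵀ) i) ∎
    where open ≡-Reasoning

  ·toℰ-split : (c : Fin m → ℚω) (j : Fin n) →
               ∑ℚω (λ i → c i *ℚω ℰ→ℚω (toℰ M i j))
                 ≡ ((map proj₁ c ·M) j , (map proj₂ c ·M) j)
  ·toℰ-split c j = begin
    ∑ℚω (λ i → c i *ℚω (M i j ℚ./ 1 , ℚ.0ℚ))
      ≡⟨ ∑-cong (ℚ.0ℚ , ℚ.0ℚ) _+ℚω_ (λ i → *ℚω-realʳ (c i) (M i j ℚ./ 1)) ⟩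
    ∑ℚω (zip (λ i → proj₁ (c i) ℚ.* (M i j ℚ./ 1))
             (λ i → proj₂ (c i) ℚ.* (M i j ℚ./ 1)))
      ≡⟨ ∑-zip ℚ.0ℚ ℚ._+_ ℚ.0ℚ ℚ._+_ (λ i → proj₁ (c i) ℚ.* (M i j ℚ./ 1))
                                     (λ i → proj₂ (c i) ℚ.* (M i j ℚ./ 1)) ⟩
    ((map proj₁ c ·M) j , (map proj₂ c ·M) j) ∎
    where open ≡-Reasoning

  Λℰ-toℰ⇔ : {v : Vecℰ n} → Λℰ (toℰ M) v ⇔ (Λℤ M (map proj₁ v) × Λℤ M (map proj₂ v))
  Λℰ-toℰ⇔ {v} = mk⇔
    (λ Λv → (λ i → proj₁ (components i (Λv i))) , (λ i → proj₂ (components i (Λv i))))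
    (λ (Λv₁ , Λv₂) i → trans (·toℰᴴ-split v i) (cong₂ _,_ (Λv₁ i) (Λv₂ i)))
    where
    components : ∀ i → ∑ℰ (λ j → v j *ℰ conjℰ (toℰ M i j)) ≡ 0ℰ →
                 (map proj₁ v ·Mᵀ) i ≡ + 0 × (map proj₂ v ·Mᵀ) i ≡ + 0
    components i Λvᵢ = ,-injective (trans (sym (·toℰᴴ-split v i)) Λvᵢ)

  Λ*ℰ-toℰ⇔ : {v : Vecℰ n} → Λ*ℰ (toℰ M) v ⇔ (Λ*ℤ M (map proj₁ v) × Λ*ℤ M (map proj₂ v))
  Λ*ℰ-toℰ⇔ {v} = mk⇔
    (λ (c , vc) → (map proj₁ c , λ j → proj₁ (components c j (vc j)))
                , (map proj₂ c , λ j → proj₂ (components c j (vc j))))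
    (λ ((c₁ , v₁c₁) , (c₂ , v₂c₂)) →
      zip c₁ c₂ , λ j → trans (·toℰ-split (zip c₁ c₂) j) (cong₂ _,_ (v₁c₁ j) (v₂c₂ j)))
    where
    components : (c : Fin m → ℚω) (j : Fin n) →
                 ∑ℚω (λ i → c i *ℚω ℰ→ℚω (toℰ M i j)) ≡ ℰ→ℚω (v j) →
                 (map proj₁ c ·M) j ≡ proj₁ (v j) ℚ./ 1 ×
                 (map proj₂ c ·M) j ≡ proj₂ (v j) ℚ./ 1
    components c j vcⱼ = ,-injective (trans (sym (·toℰ-split c j)) vcⱼ)

  ≈ℰ-toℰ⇔ : {x y : Vecℰ n} → x ≈ℰ[ toℰ M ] y ⇔
            (map proj₁ x ≈ℤ[ M ] map proj₁ y × map proj₂ x ≈ℤ[ M ] map proj₂ y)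
  ≈ℰ-toℰ⇔ = mk⇔
    (λ (a , b , Λa , Λ*b , x-y≡a+b) →
      let (Λa₁ , Λa₂) = Equivalence.to (Λℰ-toℰ⇔ {a}) Λa
          (Λ*b₁ , Λ*b₂) = Equivalence.to (Λ*ℰ-toℰ⇔ {b}) Λ*b
      in (map proj₁ a , map proj₁ b , Λa₁ , Λ*b₁ , λ j → proj₁ (,-injective (x-y≡a+b j)))
       , (map proj₂ a , map proj₂ b , Λa₂ , Λ*b₂ , λ j → proj₂ (,-injective (x-y≡a+b j))))
    (λ ((a₁ , b₁ , Λa₁ , Λ*b₁ , e₁) , (a₂ , b₂ , Λa₂ , Λ*b₂ , e₂)) →
      zip a₁ a₂ , zip b₁ b₂ ,
      Equivalence.from (Λℰ-toℰ⇔ {zip a₁ a₂}) (Λa₁ , Λa₂) ,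
      Equivalence.from (Λ*ℰ-toℰ⇔ {zip b₁ b₂}) (Λ*b₁ , Λ*b₂) ,
      λ j → cong₂ _,_ (e₁ j) (e₂ j))

  ≈ℤ-refl : (x : Vecℤ n) → x ≈ℤ[ M ] x
  ≈ℤ-refl x = (λ _ → + 0) , (λ _ → + 0) , Λℤ-zero , Λ*ℤ-zero , λ j → ℤ.+-inverseʳ (x j)
    where
    Λℤ-zero : Λℤ M (λ _ → + 0)
    Λℤ-zero i =
      trans (∑-cong (+ 0) ℤ._+_ (λ j → ℤ.*-zeroˡ (M i j))) (∑-idem (+ 0) ℤ._+_ refl {n})
    Λ*ℤ-zero : Λ*ℤ M (λ _ → + 0)
    Λ*ℤ-zero = (λ _ → ℚ.0ℚ) , λ j →
      trans (∑-cong ℚ.0ℚ ℚ._+_ (λ i → ℚ.*-zeroˡ (M i j ℚ./ 1))) (∑-idem ℚ.0ℚ ℚ._+_ refl {m})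

proposition4p3 : (m n : ℕ) (M : Mat ℤ m n) → TotallyUnimodular M → JacIso M
proposition4p3 m n M _ = record
  { f      = unzip
  ; g      = uncurry zip
  ; f-cong = λ {x} {y} → Equivalence.to (≈ℰ-toℰ⇔ M {x} {y})
  ; g-cong = λ {x} {y} → Equivalence.from (≈ℰ-toℰ⇔ M {uncurry zip x} {uncurry zip y})
  ; f-hom  = λ x y → refl² (unzip (λ j → x j +ℰ y j))
  ; f∘g    = refl²
  ; g∘f    = λ x → Equivalence.from (≈ℰ-toℰ⇔ M {x} {x}) (refl² (unzip x))
  }
  where
  refl² : (p : Vecℤ n × Vecℤ n) → proj₁ p ≈ℤ[ M ] proj₁ p × proj₂ p ≈ℤ[ M ] proj₂ p
  refl² (u , w) = ≈ℤ-refl M u , ≈ℤ-refl M w
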